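{- Let $q \in \mathbb{Q}^+$ be written as the irreducible fraction $q = \frac{c}{d}$ with $c,d$ positive integers. For $n \ge 0$ let $\mathcal{W}_{q,n}$ be the set of binary words of length $n$ such that for every maximal factor of the form $0^a1^b$ with $a>0$ one has $aq > b$, and let $w_n = |\mathcal{W}_{q,n}|$; set $w_n = 0$ for $n < 0$. Let $J$ be the set of exponents appearing in the polynomial $P_q(x,x) = \sum_{i=0}^{c-1} x^{1+\lfloor i/q\rfloor + i}$ (e.g. for $q = 3/2$, $P_q(x,x) = x + x^2 + x^4$ and $J = \{1,2,4\}$). Then for all $n \ge c+d$, $$w_n = \sum_{j \in J} w_{n-j} + w_{n-(c+d)},$$ and for $0 \le n < c+d$, $$w_n = \sum_{j \in J} w_{n-j} + w_{n-(c+d)} + 1.$$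
   Context: Here $x^\ell$ denotes the word consisting of $\ell$ copies of the symbol $x$. A maximal factor of the form $0^a1^b$ means a maximal run of $a$ consecutive zeros followed immediately by the maximal run of $b \ge 0$ consecutive ones following it. $\mathcal{W}_{q,0}$ consists of the empty word. -}

module Defs where

open import Data.Bool using (Bool; true; false; if_then_else_)
open import Data.Nat using (ℕ; zero; suc; _+_; _*_; _∸_; _<_; _≤ᵇ_; NonZero)
open import Data.Nat.Properties using (_≟_)
open import Data.Nat.DivMod using (_/_)
open import Data.List using (List; []; _∷_; _++_; replicate; length; map; upTo; deduplicate)
open import Data.List.Membership.Propositional using (_∈_)
open import Data.List.Relation.Unary.Unique.Propositional using (Unique)
open import Data.Product using (Σ; ∃; ∃₂; _×_)
open import Relation.Binary.PropositionalEquality using (_≡_)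
open import Relation.Nullary using (¬_)
open import Function.Bundles using (_⇔_)

-- Binary words; the symbol 0 is encoded as false and 1 as true.
Word : Set
Word = List Bool

-- w has a maximal factor 0^a 1^b: w = u 0^a 1^b v where the run of a zeros
-- is maximal (u does not end in 0, and the symbol after 0^a is not 0) and
-- the run of b ones following it is maximal (v does not start with 1).
MaximalFactor : Word → ℕ → ℕ → Set
MaximalFactor w a b =
  ∃₂ λ u v →
    (w ≡ u ++ replicate a false ++ replicate b true ++ v)
    × (¬ ∃ λ u′ → u ≡ u′ ++ false ∷ [])
    × (¬ ∃ λ v′ → v ≡ true ∷ v′)
    × (b ≡ 0 → ¬ ∃ λ v′ → v ≡ false ∷ v′)

-- Membership in W_{q,n} for q = c/d: length n and a q > b, i.e. b d < a c,
-- for every maximal factor 0^a 1^b with a > 0.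
InW : ℕ → ℕ → ℕ → Word → Set
InW c d n w =
  length w ≡ n × (∀ a b → 0 < a → MaximalFactor w a b → b * d < a * c)

HasSize : (Word → Set) → ℕ → Set
HasSize P k =
  Σ (List Word) λ L → Unique L × (∀ x → (x ∈ L) ⇔ P x) × (length L ≡ k)

shifted : (ℕ → ℕ) → ℕ → ℕ → ℕ
shifted w n j = if j ≤ᵇ n then w (n ∸ j) else 0

-- The set J of exponents of P_q(x,x) = Σ_{i<c} x^{1 + ⌊i/q⌋ + i},
-- with ⌊i/q⌋ = ⌊i d / c⌋, as a duplicate-free list.
J : (c d : ℕ) → .{{NonZero c}} → List ℕ
J c d = deduplicate _≟_ (map (λ i → 1 + (i * d) / c + i) (upTo c))

-- A valid word is a run of leading ones followed by blocks 0^a 1^b, where a block with b ≥ 1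
-- needs b d < a c, i.e. at least q(b) + 1 zeros with q(b) = ⌊b d / c⌋, and only the last block
-- may have b = 0.  Reading a word letter by letter, the words of length n that are empty or
-- start with 0 are counted by 1 + Σ_{b ≥ 1} w_{n - e(b)}, where e(b) = 1 + q(b) + b is the
-- length of the shortest block with b ones; adding the leading ones gives
-- w_n = w_{n-1} + 1 + Σ_{b ≥ 1} w_{n - e(b)}.  As e(b + c) = e(b) + (c + d), the terms with
-- b > c form the same sum at n - (c + d), i.e. w_{n-(c+d)} - w_{n-(c+d)-1} - 1, and the two
-- identities combine into the recurrence over J = {e(0), …, e(c - 1)}.
module Submission where

open import Defs
open import Data.Bool using (Bool; true; false; if_then_else_; _∧_; T)
open import Data.Bool.Properties using (T-≡; T-∧)
open import Data.Empty using (⊥-elim)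
open import Data.List using (List; []; _∷_; _++_; map; replicate; length; applyUpTo; deduplicate)
open import Data.List.Membership.Propositional using (_∈_)
open import Data.List.Membership.Propositional.Properties using (∈-map⁺; ∈-map⁻; ∈-++⁺ˡ; ∈-++⁺ʳ; ∈-++⁻)
open import Data.List.Membership.Propositional.Properties.WithK using (unique∧set⇒bag)
open import Data.List.Properties using (length-++; length-map; ++-assoc; applyUpTo-∷ʳ; map-upTo; map-applyUpTo; filter-all; ∷ʳ-injectiveʳ)
open import Data.List.Relation.Binary.BagAndSetEquality using (∼bag⇒↭)
open import Data.List.Relation.Binary.Permutation.Propositional.Properties using (↭-length)
open import Data.List.Relation.Unary.All using ([])
open import Data.List.Relation.Unary.All.Properties using (applyUpTo⁺₂)
open import Data.List.Relation.Unary.AllPairs using ([]; _∷_)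
open import Data.List.Relation.Unary.Any using (here)
open import Data.List.Relation.Unary.Unique.Propositional using (Unique)
import Data.List.Relation.Unary.Unique.Propositional.Properties as Unique
open import Data.Nat using (ℕ; zero; suc; pred; _+_; _*_; _∸_; _≤_; _<_; _≤ᵇ_; _<ᵇ_; z≤n; s≤s; s≤s⁻¹; z<s; NonZero)
open import Data.Nat.Coprimality using (Coprime)
open import Data.Nat.DivMod using (_/_; m*n/n≡m; m<n*o⇒m/o<n; /-monoˡ-≤; +-distrib-/-∣ˡ; 0/n≡0)
open import Data.Nat.Divisibility using (m∣m*n)
open import Data.Nat.ListAction using (sum)
open import Data.Nat.ListAction.Properties using (sum-++)
open import Data.Nat.Properties
open import Data.Nat.Tactic.RingSolver using (solve-∀)
open import Data.Product using (_×_; ∃; ∃₂; _,_; proj₁; proj₂; map₁)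
open import Data.Sum using (_⊎_; inj₁; inj₂)
open import Function using (_∘_)
open import Function.Bundles using (_⇔_; mk⇔; Equivalence)
import Function.Properties.Equivalence as ⇔
open import Relation.Binary.PropositionalEquality using (_≡_; refl; sym; trans; cong; cong₂; subst; module ≡-Reasoning)
open import Relation.Nullary using (¬_; ¬?; yes; no)
open import Relation.Nullary.Decidable using (decidable-stable)
open import Relation.Nullary.Decidable.Core using (T?)

count : (Word → Bool) → ℕ → ℕ
count P zero    = if P [] then 1 else 0
count P (suc n) = count (P ∘ (false ∷_)) n + count (P ∘ (true ∷_)) n

satisfying : (Word → Bool) → ℕ → List Word
satisfying P zero    = if P [] then [] ∷ [] else []
satisfying P (suc n) = map (false ∷_) (satisfying (P ∘ (false ∷_)) n)
                    ++ map (true ∷_) (satisfying (P ∘ (true ∷_)) n)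

length-satisfying : ∀ P n → length (satisfying P n) ≡ count P n
length-satisfying P zero with P []
... | true  = refl
... | false = refl
length-satisfying P (suc n) = trans (length-++ (map (false ∷_) F))
  (cong₂ _+_ (trans (length-map (false ∷_) F) (length-satisfying _ n))
             (trans (length-map (true ∷_) T′) (length-satisfying _ n)))
  where
  F T′ : List Word
  F  = satisfying (P ∘ (false ∷_)) n
  T′ = satisfying (P ∘ (true ∷_)) n

∈-satisfying⁺ : ∀ P x → T (P x) → x ∈ satisfying P (length x)
∈-satisfying⁺ P [] t with P []
... | true = here refl
∈-satisfying⁺ P (false ∷ x) t = ∈-++⁺ˡ (∈-map⁺ (false ∷_) (∈-satisfying⁺ (P ∘ (false ∷_)) x t))
∈-satisfying⁺ P (true ∷ x) t =
  ∈-++⁺ʳ _ (∈-map⁺ (true ∷_) (∈-satisfying⁺ (P ∘ (true ∷_)) x t))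

∈-satisfying⁻ : ∀ P n {x} → x ∈ satisfying P n → length x ≡ n × T (P x)
∈-satisfying⁻ P zero m with P [] in eq
∈-satisfying⁻ P zero (here refl) | true = refl , subst T (sym eq) _
∈-satisfying⁻ P (suc n) m with ∈-++⁻ (map (false ∷_) (satisfying (P ∘ (false ∷_)) n)) m
... | inj₁ m₀ with y , y∈ , refl ← ∈-map⁻ (false ∷_) m₀ =
  map₁ (cong suc) (∈-satisfying⁻ (P ∘ (false ∷_)) n y∈)
... | inj₂ m₁ with y , y∈ , refl ← ∈-map⁻ (true ∷_) m₁ =
  map₁ (cong suc) (∈-satisfying⁻ (P ∘ (true ∷_)) n y∈)

∈-satisfying : ∀ P n x → (x ∈ satisfying P n) ⇔ (length x ≡ n × T (P x))
∈-satisfying P n x = mk⇔ (∈-satisfying⁻ P n) λ { (refl , t) → ∈-satisfying⁺ P x t }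

satisfying-unique : ∀ P n → Unique (satisfying P n)
satisfying-unique P zero with P []
... | true  = [] ∷ []
... | false = []
satisfying-unique P (suc n) =
  Unique.++⁺ (Unique.map⁺ ∷-injectiveʳ (satisfying-unique _ n))
             (Unique.map⁺ ∷-injectiveʳ (satisfying-unique _ n)) disjoint
  where
  ∷-injectiveʳ : ∀ {b} {x y : Word} → b ∷ x ≡ b ∷ y → x ≡ y
  ∷-injectiveʳ refl = refl
  disjoint : ∀ {v} → ¬ (v ∈ map (false ∷_) (satisfying (P ∘ (false ∷_)) n)
                      × v ∈ map (true ∷_) (satisfying (P ∘ (true ∷_)) n))
  disjoint (m₀ , m₁) with _ , _ , refl ← ∈-map⁻ (false ∷_) m₀ | _ , _ , () ← ∈-map⁻ (true ∷_) m₁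

hasSize-count : ∀ P n → HasSize (λ x → length x ≡ n × T (P x)) (count P n)
hasSize-count P n =
  satisfying P n , satisfying-unique P n , ∈-satisfying P n , length-satisfying P n

hasSize-unique : ∀ {P Q : Word → Set} {k l} →
  (∀ x → P x ⇔ Q x) → HasSize P k → HasSize Q l → k ≡ l
hasSize-unique P⇔Q (L , uL , L⇔P , refl) (M , uM , M⇔Q , refl) =
  ↭-length (∼bag⇒↭ (unique∧set⇒bag uL uM
    (λ {x} → ⇔.trans (L⇔P x) (⇔.trans (P⇔Q x) (⇔.sym (M⇔Q x))))))

count-cong : ∀ {P Q} → (∀ x → P x ≡ Q x) → ∀ n → count P n ≡ count Q n
count-cong P≗Q zero rewrite P≗Q [] = refl
count-cong P≗Q (suc n) =
  cong₂ _+_ (count-cong (P≗Q ∘ (false ∷_)) n) (count-cong (P≗Q ∘ (true ∷_)) n)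

count-∧ : ∀ β P n → count (λ x → β ∧ P x) n ≡ (if β then count P n else 0)
count-∧ true  P n       = refl
count-∧ false P zero    = refl
count-∧ false P (suc n) =
  cong₂ _+_ (count-∧ false (P ∘ (false ∷_)) n) (count-∧ false (P ∘ (true ∷_)) n)

∑ : ℕ → (ℕ → ℕ) → ℕ
∑ n f = sum (applyUpTo f n)

syntax ∑ n (λ k → e) = ∑[ k < n ] e

∑-cong : ∀ n {f g} → (∀ k → f k ≡ g k) → ∑ n f ≡ ∑ n g
∑-cong zero    f≗g = refl
∑-cong (suc n) f≗g = cong₂ _+_ (f≗g 0) (∑-cong n (f≗g ∘ suc))

∑-+ : ∀ n f g → ∑[ k < n ] (f k + g k) ≡ ∑ n f + ∑ n g
∑-+ zero    f g = refl
∑-+ (suc n) f g = trans (cong (f 0 + g 0 +_) (∑-+ n (f ∘ suc) (g ∘ suc)))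
                        (+-assoc-middle (f 0) (g 0) _ _)
  where
  +-assoc-middle : ∀ a b x y → a + b + (x + y) ≡ a + x + (b + y)
  +-assoc-middle = solve-∀

∑-zero : ∀ n {f} → (∀ k → f k ≡ 0) → ∑ n f ≡ 0
∑-zero zero    f≗0 = refl
∑-zero (suc n) f≗0 = cong₂ _+_ (f≗0 0) (∑-zero n (f≗0 ∘ suc))

∑-split : ∀ m n f → ∑ (m + n) f ≡ ∑ m f + ∑[ k < n ] f (m + k)
∑-split zero    n f = refl
∑-split (suc m) n f = trans (cong (f 0 +_) (∑-split m n (f ∘ suc))) (sym (+-assoc (f 0) _ _))

∑-last : ∀ n f → ∑ (suc n) f ≡ ∑ n f + f n
∑-last n f = begin
  sum (applyUpTo f (suc n))           ≡⟨ cong sum (applyUpTo-∷ʳ f n) ⟨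
  sum (applyUpTo f n ++ f n ∷ [])     ≡⟨ sum-++ (applyUpTo f n) (f n ∷ []) ⟩
  sum (applyUpTo f n) + (f n + 0)     ≡⟨ cong (sum (applyUpTo f n) +_) (+-identityʳ (f n)) ⟩
  sum (applyUpTo f n) + f n           ∎
  where open ≡-Reasoning

∑-extend : ∀ {m M} f → m ≤ M → (∀ k → m ≤ k → f k ≡ 0) → ∑ M f ≡ ∑ m f
∑-extend {m} f m≤M f≥m≡0 with r , refl ← m≤n⇒∃[o]m+o≡n m≤M =
  trans (∑-split m r f)
        (trans (cong (∑ m f +_) (∑-zero r (λ k → f≥m≡0 (m + k) (m≤m+n m k))))
               (+-identityʳ _))

shifted-suc : ∀ F n j → shifted F (suc n) (suc j) ≡ shifted F n j
shifted-suc F n zero    = refl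
shifted-suc F n (suc j) = refl

shifted-out : ∀ F {n j} → n < j → shifted F n j ≡ 0
shifted-out F {zero}  {suc j} _         = refl
shifted-out F {suc n} {suc j} (s≤s n<j) = trans (shifted-suc F n j) (shifted-out F n<j)

shifted-shifted : ∀ F i n j → shifted (λ m → shifted F m i) n j ≡ shifted F n (j + i)
shifted-shifted F i n       zero    = refl
shifted-shifted F i zero    (suc j) = refl
shifted-shifted F i (suc n) (suc j) = begin
  shifted (λ m → shifted F m i) (suc n) (suc j) ≡⟨ shifted-suc (λ m → shifted F m i) n j ⟩
  shifted (λ m → shifted F m i) n j             ≡⟨ shifted-shifted F i n j ⟩
  shifted F n (j + i)                           ≡⟨ shifted-suc F n (j + i) ⟨
  shifted F (suc n) (suc j + i)                 ∎
  where open ≡-Reasoning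

shifted-in : ∀ F {n j} → j ≤ n → shifted F n j ≡ F (n ∸ j)
shifted-in F j≤n rewrite Equivalence.to T-≡ (≤⇒≤ᵇ j≤n) = refl

shifted-pointwise : ∀ {F G H : ℕ → ℕ} → (∀ m → F m ≡ G m + H m) →
  ∀ n j → shifted F n j ≡ shifted G n j + shifted H n j
shifted-pointwise F≗G+H n j with j ≤ᵇ n
... | true  = F≗G+H _
... | false = refl

shifted-cong-≤ : ∀ {F G : ℕ → ℕ} n → (∀ m → m ≤ n → F m ≡ G m) →
  ∀ j → shifted F n j ≡ shifted G n j
shifted-cong-≤ n F≗G j with j ≤ᵇ n
... | true  = F≗G (n ∸ j) (m∸n≤m n j)
... | false = refl

shifted-∑ : ∀ M (G : ℕ → ℕ → ℕ) n j →
  ∑[ k < M ] shifted (G k) n j ≡ shifted (λ m → ∑[ k < M ] G k m) n j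
shifted-∑ M G n j with j ≤ᵇ n
... | true  = refl
... | false = ∑-zero M (λ _ → refl)

deduplicate-increasing : ∀ n (f : ℕ → ℕ) → (∀ i → f i < f (suc i)) →
  deduplicate _≟_ (applyUpTo f n) ≡ applyUpTo f n
deduplicate-increasing zero    f f↑ = refl
deduplicate-increasing (suc n) f f↑
  rewrite deduplicate-increasing n (f ∘ suc) (f↑ ∘ suc) =
  cong (f 0 ∷_) (filter-all (λ y → ¬? (f 0 ≟ y))
    (applyUpTo⁺₂ (f ∘ suc) n (λ i → <⇒≢ (f0<f[1+i] i))))
  where
  f0<f[1+i] : ∀ i → f 0 < f (suc i)
  f0<f[1+i] zero    = f↑ 0
  f0<f[1+i] (suc i) = <-trans (f0<f[1+i] i) (f↑ (suc i))

m∸n≡suc[m∸suc[n]] : ∀ {m n} → n < m → m ∸ n ≡ suc (m ∸ suc n)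
m∸n≡suc[m∸suc[n]] {suc m} {zero}  _         = refl
m∸n≡suc[m∸suc[n]] {suc m} {suc n} (s≤s n<m) = m∸n≡suc[m∸suc[n]] n<m

replicate-∷ : ∀ {A : Set} k (x : A) r → replicate k x ++ x ∷ r ≡ x ∷ replicate k x ++ r
replicate-∷ zero    x r = refl
replicate-∷ (suc k) x r = cong (x ∷_) (replicate-∷ k x r)

EndsIn0 : Word → Set
EndsIn0 u = ∃ λ u′ → u ≡ u′ ++ false ∷ []

¬EndsIn0-[] : ¬ EndsIn0 []
¬EndsIn0-[] ([] , ())
¬EndsIn0-[] (_ ∷ _ , ())

¬EndsIn0-∷ʳ : ∀ u → ¬ EndsIn0 (u ++ true ∷ [])
¬EndsIn0-∷ʳ u (u′ , eq) with () ← ∷ʳ-injectiveʳ u u′ eq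

¬EndsIn0-tail : ∀ x u → ¬ EndsIn0 (x ∷ u) → ¬ EndsIn0 u
¬EndsIn0-tail x u ¬end (u′ , eq) = ¬end (x ∷ u′ , cong (x ∷_) eq)

module Blocks (c d : ℕ) .{{_ : NonZero c}} where

  q : ℕ → ℕ
  q b = b * d / c

  -- a = 0 stands for the leading ones of a word, which are unconstrained.
  ok : ℕ → ℕ → Bool
  ok zero    b = true
  ok (suc a) b = b * d <ᵇ suc a * c

  -- run a b w: w is an admissible continuation of a word ending in 0^a 1^b.
  run : ℕ → ℕ → Word → Bool
  run a b       []          = ok a b
  run a b       (true ∷ w)  = run a (suc b) w
  run a zero    (false ∷ w) = run (suc a) zero w
  run a (suc b) (false ∷ w) = ok a (suc b) ∧ run 1 0 w

  valid : Word → Bool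
  valid = run 0 0

  ok-suc⇒q≤ : ∀ a b → T (ok (suc a) b) → q b ≤ a
  ok-suc⇒q≤ a b t = s≤s⁻¹ (m<n*o⇒m/o<n (<ᵇ⇒< (b * d) (suc a * c) t))

  ¬ok-suc⇒<q : ∀ a b → ¬ T (ok (suc a) b) → a < q b
  ¬ok-suc⇒<q a b ¬t = subst (_≤ q b) (m*n/n≡m (suc a) c) (/-monoˡ-≤ c (≮⇒≥ (¬t ∘ <⇒<ᵇ)))

  ok-no-ones : ∀ a → ok (suc a) 0 ≡ true
  ok-no-ones a = Equivalence.to T-≡ (<⇒<ᵇ (m<n⇒m<n*o c (z<s {a})))

  run-zeros : ∀ k a x → run a 0 (replicate k false ++ x) ≡ run (a + k) 0 x
  run-zeros zero    a x = cong (λ a → run a 0 x) (sym (+-identityʳ a))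
  run-zeros (suc k) a x = trans (run-zeros k (suc a) x) (cong (λ a → run a 0 x) (sym (+-suc a k)))

  run-ones : ∀ k a b x → run a b (replicate k true ++ x) ≡ run a (b + k) x
  run-ones zero    a b x = cong (λ b → run a b x) (sym (+-identityʳ b))
  run-ones (suc k) a b x = trans (run-ones k a (suc b) x) (cong (λ b → run a b x) (sym (+-suc b k)))

  run-to-block : ∀ u {a b} x → ¬ EndsIn0 u → (u ≡ [] → a ≡ 0 ⊎ 0 < b) →
    T (run a b (u ++ false ∷ x)) → T (run 1 0 x)
  run-to-block [] {zero} {zero} x _ _ t = t
  run-to-block [] {suc a} {zero} x _ boundary t with boundary refl
  ... | inj₁ ()
  ... | inj₂ ()
  run-to-block [] {a} {suc b} x _ _ t = proj₂ (Equivalence.to (T-∧ {ok a (suc b)}) t)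
  run-to-block (true ∷ u) x ¬end _ t = run-to-block u x (¬EndsIn0-tail true u ¬end) (λ _ → inj₂ z<s) t
  run-to-block (false ∷ []) x ¬end _ t = ⊥-elim (¬end ([] , refl))
  run-to-block (false ∷ y ∷ u) {a} {zero} x ¬end _ t =
    run-to-block (y ∷ u) x (¬EndsIn0-tail false _ ¬end) (λ ()) t
  run-to-block (false ∷ y ∷ u) {a} {suc b} x ¬end _ t =
    run-to-block (y ∷ u) x (¬EndsIn0-tail false _ ¬end) (λ ())
      (proj₂ (Equivalence.to (T-∧ {ok a (suc b)}) t))

  run-last-block : ∀ a b v → ¬ (∃ λ v′ → v ≡ true ∷ v′) → (b ≡ 0 → ¬ ∃ λ v′ → v ≡ false ∷ v′) →
    T (run (suc a) b v) → b * d < suc a * c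
  run-last-block a b       []          _    _    t = <ᵇ⇒< _ _ t
  run-last-block a b       (true ∷ v)  ¬one _    _ = ⊥-elim (¬one (v , refl))
  run-last-block a zero    (false ∷ v) _    ¬zero _ = ⊥-elim (¬zero refl (v , refl))
  run-last-block a (suc b) (false ∷ v) _    _    t =
    <ᵇ⇒< _ _ (proj₁ (Equivalence.to (T-∧ {ok (suc a) (suc b)}) t))

  valid-sound : ∀ w → T (valid w) → ∀ a b → 0 < a → MaximalFactor w a b → b * d < a * c
  valid-sound w t (suc a) b _ (u , v , refl , ¬end , ¬one , ¬zero) =
    run-last-block a b v ¬one ¬zero
      (subst T (run-ones b (suc a) 0 v)
        (subst T (run-zeros a 1 (replicate b true ++ v))
          (run-to-block u (replicate a false ++ replicate b true ++ v) ¬end (λ _ → inj₁ refl) t)))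

  Bad : Word → Set
  Bad w = ∃₂ λ a b → 0 < a × MaximalFactor w a b × ¬ (b * d < a * c)

  run-false⇒Bad : ∀ x pre a b → ¬ EndsIn0 pre → ¬ T (run a b x) →
    Bad (pre ++ replicate a false ++ replicate b true ++ x)
  run-false⇒Bad [] pre zero b _ ¬t = ⊥-elim (¬t _)
  run-false⇒Bad [] pre (suc a) b ¬end ¬t =
    suc a , b , z<s , (pre , [] , refl , ¬end , (λ { (_ , ()) }) , λ _ → λ { (_ , ()) }) , ¬t ∘ <⇒<ᵇ
  run-false⇒Bad (true ∷ x) pre a b ¬end ¬t =
    subst Bad (cong (λ r → pre ++ replicate a false ++ r) (sym (replicate-∷ b true x)))
      (run-false⇒Bad x pre a (suc b) ¬end ¬t)
  run-false⇒Bad (false ∷ x) pre a zero ¬end ¬t =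
    subst Bad (cong (pre ++_) (sym (replicate-∷ a false x)))
      (run-false⇒Bad x pre (suc a) zero ¬end ¬t)
  run-false⇒Bad (false ∷ x) pre a (suc b) ¬end ¬t with T? (ok a (suc b))
  ... | yes t = subst Bad next-block
        (run-false⇒Bad x _ 1 0 (¬EndsIn0-∷ʳ _) (¬t ∘ λ t′ → Equivalence.from (T-∧ {ok a (suc b)}) (t , t′)))
    where
    open ≡-Reasoning
    next-block : ((pre ++ replicate a false ++ replicate b true) ++ true ∷ []) ++ false ∷ x
               ≡ pre ++ replicate a false ++ replicate (suc b) true ++ false ∷ x
    next-block = begin
      ((pre ++ replicate a false ++ replicate b true) ++ true ∷ []) ++ false ∷ x
        ≡⟨ ++-assoc (pre ++ replicate a false ++ replicate b true) (true ∷ []) (false ∷ x) ⟩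
      (pre ++ replicate a false ++ replicate b true) ++ true ∷ false ∷ x
        ≡⟨ ++-assoc pre (replicate a false ++ replicate b true) (true ∷ false ∷ x) ⟩
      pre ++ (replicate a false ++ replicate b true) ++ true ∷ false ∷ x
        ≡⟨ cong (pre ++_) (++-assoc (replicate a false) (replicate b true) (true ∷ false ∷ x)) ⟩
      pre ++ replicate a false ++ replicate b true ++ true ∷ false ∷ x
        ≡⟨ cong (λ r → pre ++ replicate a false ++ r) (replicate-∷ b true (false ∷ x)) ⟩
      pre ++ replicate a false ++ replicate (suc b) true ++ false ∷ x ∎
  run-false⇒Bad (false ∷ x) pre zero (suc b) ¬end ¬t | no ¬ok = ⊥-elim (¬ok _)
  run-false⇒Bad (false ∷ x) pre (suc a) (suc b) ¬end ¬t | no ¬ok =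
    suc a , suc b , z<s , (pre , false ∷ x , refl , ¬end , (λ { (_ , ()) }) , λ ()) , ¬ok ∘ <⇒<ᵇ

  valid-complete : ∀ w → (∀ a b → 0 < a → MaximalFactor w a b → b * d < a * c) → T (valid w)
  valid-complete w allowed = decidable-stable (T? (valid w)) λ ¬t →
    let a , b , 0<a , factor , ¬lt = run-false⇒Bad w [] 0 0 ¬EndsIn0-[] ¬t
    in  ¬lt (allowed a b 0<a factor)

  InW⇔valid : ∀ n w → InW c d n w ⇔ (length w ≡ n × T (valid w))
  InW⇔valid n w = mk⇔ (λ (l , allowed) → l , valid-complete w allowed)
                      (λ (l , t) → l , valid-sound w t)

  -- noLeadingOnes n counts the valid words of length n that are empty or start with 0.
  noLeadingOnes : ℕ → ℕ
  noLeadingOnes zero    = 1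
  noLeadingOnes (suc n) = count (run 1 0) n

  validCount : ℕ → ℕ
  validCount = count valid

  run-leading-ones : ∀ b w → run 0 b w ≡ valid w
  run-leading-ones b []          = refl
  run-leading-ones b (true ∷ w)  = trans (run-leading-ones (suc b) w) (sym (run-leading-ones 1 w))
  run-leading-ones zero    (false ∷ w) = refl
  run-leading-ones (suc b) (false ∷ w) = refl

  validCount-split : ∀ m → validCount m ≡ shifted validCount m 1 + noLeadingOnes m
  validCount-split zero    = refl
  validCount-split (suc n) =
    trans (cong (noLeadingOnes (suc n) +_) (count-cong (run-leading-ones 1) n))
          (+-comm (noLeadingOnes (suc n)) (validCount n))

  shifted-validCount-split : ∀ n j →
    shifted validCount n j ≡ shifted validCount n (suc j) + shifted noLeadingOnes n j
  shifted-validCount-split n j =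
    trans (shifted-pointwise {G = λ m → shifted validCount m 1} {H = noLeadingOnes} validCount-split n j)
          (cong (_+ shifted noLeadingOnes n j)
                (trans (shifted-shifted validCount 1 n j) (cong (shifted validCount n) (+-comm j 1))))

  count-run-ones : ∀ n a b → count (run a (suc b)) n
    ≡ ∑[ k < suc n ] (if ok a (k + suc b) then shifted noLeadingOnes n k else 0)
  count-run-ones zero    a b = sym (+-identityʳ _)
  count-run-ones (suc n) a b =
    cong₂ _+_ (count-∧ (ok a (suc b)) (run 1 0) n)
      (trans (count-run-ones n a (suc b)) (∑-cong (suc n) λ k →
        cong₂ (λ x y → if ok a x then y else 0)
          (+-suc k (suc b)) (sym (shifted-suc noLeadingOnes n k))))

  count-run-zeros-term : ∀ n a k → shifted validCount (suc n) ((q (suc k) ∸ a) + suc k)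
    ≡ shifted validCount n ((q (suc k) ∸ suc a) + suc k)
      + (if ok (suc a) (suc k) then shifted noLeadingOnes n k else 0)
  count-run-zeros-term n a k with ok (suc a) (suc k) in ok≡
  ... | true with q≤a ← ok-suc⇒q≤ a (suc k) (subst T (sym ok≡) _)
    rewrite m≤n⇒m∸n≡0 q≤a | m≤n⇒m∸n≡0 (m≤n⇒m≤1+n q≤a) =
    trans (shifted-suc validCount n k) (shifted-validCount-split n k)
  ... | false with a<q ← ¬ok-suc⇒<q a (suc k) (subst T ok≡)
    rewrite m∸n≡suc[m∸suc[n]] a<q =
    trans (shifted-suc validCount n ((q (suc k) ∸ suc a) + suc k)) (sym (+-identityʳ _))

  -- After 0^(a+1), a block with b ones still needs q b ∸ a zeros before its b ones.
  count-run-zeros : ∀ n a → count (run (suc a) 0) n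
    ≡ 1 + ∑[ k < n ] shifted validCount n ((q (suc k) ∸ a) + suc k)
  count-run-zeros zero    a rewrite ok-no-ones a = refl
  count-run-zeros (suc n) a = begin
    count (run (suc (suc a)) 0) n + count (run (suc a) 1) n
      ≡⟨ cong₂ _+_ (count-run-zeros n (suc a)) (count-run-ones n (suc a) 0) ⟩
    1 + (∑[ k < n ] V (suc a) k + ∑[ k < suc n ] N k)
      ≡⟨ cong (λ x → 1 + (x + ∑[ k < suc n ] N k)) (∑-extend (V (suc a)) (n≤1+n n) beyond-n) ⟨
    1 + (∑[ k < suc n ] V (suc a) k + ∑[ k < suc n ] N k)
      ≡⟨ cong (1 +_) (∑-+ (suc n) (V (suc a)) N) ⟨
    1 + ∑[ k < suc n ] (V (suc a) k + N k)
      ≡⟨ cong (1 +_) (∑-cong (suc n) λ k →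
           trans (cong (λ x → V (suc a) k + (if ok (suc a) x then shifted noLeadingOnes n k else 0)) (+-comm k 1))
                 (sym (count-run-zeros-term n a k))) ⟩
    1 + ∑[ k < suc n ] shifted validCount (suc n) ((q (suc k) ∸ a) + suc k) ∎
    where
    open ≡-Reasoning
    V : ℕ → ℕ → ℕ
    V a k = shifted validCount n ((q (suc k) ∸ a) + suc k)
    N : ℕ → ℕ
    N k = if ok (suc a) (k + 1) then shifted noLeadingOnes n k else 0
    beyond-n : ∀ k → n ≤ k → V (suc a) k ≡ 0
    beyond-n k n≤k = shifted-out validCount (<-≤-trans (s≤s n≤k) (m≤n+m (suc k) (q (suc k) ∸ suc a)))

  exponent : ℕ → ℕ
  exponent i = 1 + q i + i

  i<exponent : ∀ i → i < exponent i
  i<exponent i = s≤s (m≤n+m i (q i))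

  exponent-increasing : ∀ i → exponent i < exponent (suc i)
  exponent-increasing i = s≤s (+-mono-≤-< (/-monoˡ-≤ c (*-monoˡ-≤ d (n≤1+n i))) (n<1+n i))

  exponent-zero : exponent 0 ≡ 1
  exponent-zero = cong (λ x → 1 + x + 0) (0/n≡0 c)

  q-c : q c ≡ d
  q-c = trans (cong (_/ c) (*-comm c d)) (m*n/n≡m d c)

  exponent-c : exponent c ≡ suc (c + d)
  exponent-c = cong suc (trans (cong (_+ c) q-c) (+-comm d c))

  exponent-periodic : ∀ i → exponent (c + i) ≡ (c + d) + exponent i
  exponent-periodic i = trans (cong (λ x → 1 + x + (c + i)) q-periodic) (rearrange (q i) c d i)
    where
    q-periodic : q (c + i) ≡ d + q i
    q-periodic = trans (cong (_/ c) (*-distribʳ-+ d c i))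
                       (trans (+-distrib-/-∣ˡ (i * d) (m∣m*n d)) (cong (_+ q i) q-c))
    rearrange : ∀ x c d i → 1 + (d + x) + (c + i) ≡ (c + d) + (1 + x + i)
    rearrange = solve-∀

  noLeadingOnes-suc : ∀ n →
    noLeadingOnes (suc n) ≡ 1 + ∑[ k < n ] shifted validCount (suc n) (exponent (suc k))
  noLeadingOnes-suc n = trans (count-run-zeros n 0)
    (cong (1 +_) (∑-cong n λ k → sym (shifted-suc validCount n (q (suc k) + suc k))))

  -- blockSum m = Σ_{b ≥ 1} w_{m - exponent b}; only b ≤ m contribute.
  blockSum : ℕ → ℕ
  blockSum m = ∑[ k < m ] shifted validCount m (exponent (suc k))

  blockSum-bound : ∀ {m M} → m ≤ suc M →
    ∑[ k < M ] shifted validCount m (exponent (suc k)) ≡ blockSum m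
  blockSum-bound {m} m≤1+M =
    trans (∑-extend f (pred-mono-≤ m≤1+M) vanishes) (sym (∑-extend f (pred[n]≤n {m}) vanishes))
    where
    f : ℕ → ℕ
    f k = shifted validCount m (exponent (suc k))
    vanishes : ∀ k → pred m ≤ k → f k ≡ 0
    vanishes k pred[m]≤k = shifted-out validCount (≤-<-trans (m≤1+k m pred[m]≤k) (i<exponent (suc k)))
      where
      m≤1+k : ∀ m {k} → pred m ≤ k → m ≤ suc k
      m≤1+k zero    _ = z≤n
      m≤1+k (suc m) p = s≤s p

  validCount-via-blockSum : ∀ m → validCount m ≡ shifted validCount m 1 + blockSum m + 1
  validCount-via-blockSum zero    = refl
  validCount-via-blockSum (suc n) = begin
    validCount (suc n)                   ≡⟨ validCount-split (suc n) ⟩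
    validCount n + noLeadingOnes (suc n) ≡⟨ cong (validCount n +_) (noLeadingOnes-suc n) ⟩
    validCount n + (1 + ∑[ k < n ] shifted validCount (suc n) (exponent (suc k)))
      ≡⟨ cong (λ x → validCount n + (1 + x)) (blockSum-bound ≤-refl) ⟩
    validCount n + (1 + blockSum (suc n)) ≡⟨ +-suc (validCount n) (blockSum (suc n)) ⟩
    suc (validCount n + blockSum (suc n)) ≡⟨ +-comm 1 _ ⟩
    validCount n + blockSum (suc n) + 1  ∎
    where open ≡-Reasoning

  shifted-validCount-via-blockSum : ∀ n j → shifted validCount n j
    ≡ shifted validCount n (suc j) + shifted blockSum n j + shifted (λ _ → 1) n j
  shifted-validCount-via-blockSum n j = begin
    shifted validCount n j
      ≡⟨ shifted-pointwise {G = λ m → shifted validCount m 1 + blockSum m} {H = λ _ → 1} validCount-via-blockSum n j ⟩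
    shifted (λ m → shifted validCount m 1 + blockSum m) n j + shifted (λ _ → 1) n j
      ≡⟨ cong (_+ shifted (λ _ → 1) n j)
           (shifted-pointwise {G = λ m → shifted validCount m 1} {H = blockSum} (λ _ → refl) n j) ⟩
    shifted (λ m → shifted validCount m 1) n j + shifted blockSum n j + shifted (λ _ → 1) n j
      ≡⟨ cong (λ x → x + shifted blockSum n j + shifted (λ _ → 1) n j)
           (trans (shifted-shifted validCount 1 n j) (cong (shifted validCount n) (+-comm j 1))) ⟩
    shifted validCount n (suc j) + shifted blockSum n j + shifted (λ _ → 1) n j ∎
    where open ≡-Reasoning

  blockSum-periodic : ∀ n →
    blockSum n ≡ ∑[ k < c ] shifted validCount n (exponent (suc k)) + shifted blockSum n (c + d)
  blockSum-periodic n = begin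
    blockSum n                         ≡⟨ blockSum-bound (m≤n⇒m≤1+n (m≤n+m n c)) ⟨
    ∑ (c + n) f                        ≡⟨ ∑-split c n f ⟩
    ∑ c f + ∑[ k < n ] f (c + k)       ≡⟨ cong (∑ c f +_) tail ⟩
    ∑ c f + shifted blockSum n (c + d) ∎
    where
    open ≡-Reasoning
    f : ℕ → ℕ
    f k = shifted validCount n (exponent (suc k))
    tail : ∑[ k < n ] f (c + k) ≡ shifted blockSum n (c + d)
    tail = begin
      ∑[ k < n ] f (c + k)
        ≡⟨ ∑-cong n (λ k → cong (shifted validCount n)
             (trans (cong exponent (sym (+-suc c k))) (exponent-periodic (suc k)))) ⟩
      ∑[ k < n ] shifted validCount n ((c + d) + exponent (suc k))
        ≡⟨ ∑-cong n (λ k → shifted-shifted validCount (exponent (suc k)) n (c + d)) ⟨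
      ∑[ k < n ] shifted (λ m → shifted validCount m (exponent (suc k))) n (c + d)
        ≡⟨ shifted-∑ n (λ k m → shifted validCount m (exponent (suc k))) n (c + d) ⟩
      shifted (λ m → ∑[ k < n ] shifted validCount m (exponent (suc k))) n (c + d)
        ≡⟨ shifted-cong-≤ n (λ m m≤n → blockSum-bound (m≤n⇒m≤1+n m≤n)) (c + d) ⟩
      shifted blockSum n (c + d) ∎

  validCount-recurrence : ∀ n → validCount n + shifted (λ _ → 1) n (c + d)
    ≡ ∑[ i < c ] shifted validCount n (exponent i) + shifted validCount n (c + d) + 1
  validCount-recurrence n = begin
    validCount n + one
      ≡⟨ cong (_+ one) (validCount-via-blockSum n) ⟩
    w 1 + blockSum n + 1 + one
      ≡⟨ cong (λ x → w 1 + x + 1 + one) (blockSum-periodic n) ⟩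
    w 1 + (∑[ k < c ] w (exponent (suc k)) + B) + 1 + one
      ≡⟨ regroup (w 1) (∑[ k < c ] w (exponent (suc k))) B one ⟩
    (w 1 + ∑[ k < c ] w (exponent (suc k))) + (B + one) + 1
      ≡⟨ cong (λ x → x + (B + one) + 1) first-and-last ⟩
    (∑[ i < c ] w (exponent i) + w (exponent c)) + (B + one) + 1
      ≡⟨ regroup′ (∑[ i < c ] w (exponent i)) (w (exponent c)) B one ⟩
    ∑[ i < c ] w (exponent i) + (w (exponent c) + B + one) + 1
      ≡⟨ cong (λ x → ∑[ i < c ] w (exponent i) + (w x + B + one) + 1) exponent-c ⟩
    ∑[ i < c ] w (exponent i) + (w (suc (c + d)) + B + one) + 1
      ≡⟨ cong (λ x → ∑[ i < c ] w (exponent i) + x + 1) (shifted-validCount-via-blockSum n (c + d)) ⟨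
    ∑[ i < c ] w (exponent i) + w (c + d) + 1 ∎
    where
    open ≡-Reasoning
    w : ℕ → ℕ
    w = shifted validCount n
    B one : ℕ
    B   = shifted blockSum n (c + d)
    one = shifted (λ _ → 1) n (c + d)
    first-and-last : w 1 + ∑[ k < c ] w (exponent (suc k)) ≡ ∑[ i < c ] w (exponent i) + w (exponent c)
    first-and-last = trans (cong (λ x → w x + ∑[ k < c ] w (exponent (suc k))) (sym exponent-zero))
                           (∑-last c (w ∘ exponent))
    regroup : ∀ x s b o → x + (s + b) + 1 + o ≡ x + s + (b + o) + 1
    regroup = solve-∀
    regroup′ : ∀ s x b o → s + x + (b + o) + 1 ≡ s + (x + b + o) + 1
    regroup′ = solve-∀

theorem2 : (c d : ℕ) .{{_ : NonZero c}} .{{_ : NonZero d}} → Coprime c d →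
    (w : ℕ → ℕ) → (∀ n → HasSize (InW c d n) (w n)) →
    (∀ n → c + d ≤ n →
      w n ≡ sum (map (shifted w n) (J c d)) + shifted w n (c + d))
    × (∀ n → n < c + d →
      w n ≡ sum (map (shifted w n) (J c d)) + shifted w n (c + d) + 1)
theorem2 c d _ w w-size =
    (λ n c+d≤n → +-cancelʳ-≡ 1 (w n) _
       (trans (cong (w n +_) (sym (shifted-in (λ _ → 1) c+d≤n))) (recurrence n)))
  , (λ n n<c+d → trans (sym (+-identityʳ (w n)))
       (trans (cong (w n +_) (sym (shifted-out (λ _ → 1) n<c+d))) (recurrence n)))
  where
  open Blocks c d
  w≡validCount : ∀ n → w n ≡ validCount n
  w≡validCount n = hasSize-unique (InW⇔valid n) (w-size n) (hasSize-count valid n)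
  J≡exponents : J c d ≡ applyUpTo exponent c
  J≡exponents = trans (cong (deduplicate _≟_) (map-upTo exponent c))
                      (deduplicate-increasing c exponent exponent-increasing)
  shifted-w : ∀ n j → shifted w n j ≡ shifted validCount n j
  shifted-w n = shifted-cong-≤ n (λ m _ → w≡validCount m)
  sum-J : ∀ n → sum (map (shifted w n) (J c d)) ≡ ∑[ i < c ] shifted validCount n (exponent i)
  sum-J n = trans (cong (sum ∘ map (shifted w n)) J≡exponents)
                  (trans (cong sum (map-applyUpTo exponent (shifted w n) c))
                         (∑-cong c (shifted-w n ∘ exponent)))
  recurrence : ∀ n → w n + shifted (λ _ → 1) n (c + d)
    ≡ sum (map (shifted w n) (J c d)) + shifted w n (c + d) + 1
  recurrence n = trans (cong (_+ shifted (λ _ → 1) n (c + d)) (w≡validCount n))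
    (trans (validCount-recurrence n)
           (sym (cong₂ (λ s x → s + x + 1) (sum-J n) (shifted-w n (c + d)))))
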